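{- Let $c>0$, let $t$ be even, and let $G$ be an $\mathrm{ORS}_n(r,t)$ graph with $r = cn$, with ordered matchings $M_1,\dots,M_t$ as in the definition. Partition these matchings into $\mathcal{M} = \{M_1, \ldots, M_{t/2}\}$ and $\mathcal{M}' = \{M_{t/2+1}, \ldots, M_t\}$. Suppose that for every vertex $v$ of $G$, $\deg_{\mathcal{M}'}(v) \geq \delta c t$ for some $\delta > 0$. Then there exists an $\mathrm{ORS}_{n'}(cn, t')$ graph $H$ on $n' < (1-\delta c^2/2)n$ vertices where $t' \geq \delta c^2 t/(8 \cdot 2^x)$ and $x = 4n/(ct)$.
   Context: An $n$-vertex graph is an $\mathrm{ORS}_n(r,t)$ graph if its edge set can be decomposed into an ordered list of $t$ edge-disjoint matchings $M_1,\dots,M_t$, each of size $r$, such that for every $i\in[t]$, $M_i$ is an induced matching in $M_1\cup\cdots\cup M_i$ (no edge of $M_1\cup\cdots\cup M_i$ outside $M_i$ has both endpoints matched by $M_i$). $\deg_{\mathcal{M}'}(v)$ is the number of matchings in $\mathcal{M}'$ that match $v$ (equivalently the degree of $v$ in the union of the matchings of $\mathcal{M}'$). -}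

module Defs where

open import Data.Nat as ℕ using (ℕ; zero; suc; _≤_; _<_)
open import Data.Integer as ℤ using (ℤ; +_)
open import Data.Rational as ℚ using (ℚ; ↥_; ↧ₙ_; 0ℚ; 1ℚ)
open import Data.Fin using (Fin; toℕ)
open import Data.Fin.Properties using (any?)
open import Data.Fin as F using ()
open import Data.Product using (Σ; ∃; _×_; _,_; proj₁; proj₂)
open import Data.Sum using (_⊎_)
open import Data.Bool using (Bool; true; false)
open import Relation.Nullary using (¬_; Dec; does)
open import Relation.Nullary.Decidable using (_⊎-dec_; _×-dec_)
open import Relation.Binary.PropositionalEquality using (_≡_; _≢_)

Edge : ℕ → Set
Edge n = Fin n × Fin n

IsEndpoint : ∀ {n} → Fin n → Edge n → Set
IsEndpoint v e = v ≡ proj₁ e ⊎ v ≡ proj₂ e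

SameEdge : ∀ {n} → Edge n → Edge n → Set
SameEdge e f = (proj₁ e ≡ proj₁ f × proj₂ e ≡ proj₂ f)
             ⊎ (proj₁ e ≡ proj₂ f × proj₂ e ≡ proj₁ f)

ShareVertex : ∀ {n} → Edge n → Edge n → Set
ShareVertex e f = IsEndpoint (proj₁ e) f ⊎ IsEndpoint (proj₂ e) f

-- An ordered list of t matchings each of size r in a graph on Fin n:
-- M i k is the k-th edge of the i-th matching M_(i+1).
Matchings : ℕ → ℕ → ℕ → Set
Matchings n r t = Fin t → Fin r → Edge n

MatchedBy : ∀ {n r t} → Matchings n r t → Fin t → Fin n → Set
MatchedBy {r = r} M i v = Σ (Fin r) λ k → IsEndpoint v (M i k)

-- The graph G = M_1 ∪ ... ∪ M_t is an ORS_n(r,t) graph with this ordered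
-- decomposition:
record IsORS {n r t : ℕ} (M : Matchings n r t) : Set where
  field
    loopless     : ∀ i k → proj₁ (M i k) ≢ proj₂ (M i k)
    matching     : ∀ i k k' → k ≢ k' → ¬ ShareVertex (M i k) (M i k')
    edgeDisjoint : ∀ i j k k' → i ≢ j → ¬ SameEdge (M i k) (M j k')
    -- M i is induced in M_1 ∪ ... ∪ M_i : no edge of an earlier matching
    -- (edges of M i itself are in M i) has both endpoints matched by M i
    induced      : ∀ i j k → toℕ j ℕ.< toℕ i →
                   ¬ (MatchedBy M i (proj₁ (M j k)) × MatchedBy M i (proj₂ (M j k)))

ORS : ℕ → ℕ → ℕ → Set
ORS n r t = Σ (Matchings n r t) IsORS

countFin : ∀ {m} → (Fin m → Bool) → ℕ
countFin {zero}  f = 0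
countFin {suc m} f with f F.zero
... | true  = suc (countFin (λ i → f (F.suc i)))
... | false = countFin (λ i → f (F.suc i))

matchedBy? : ∀ {n r t} (M : Matchings n r t) i v → Dec (MatchedBy M i v)
matchedBy? M i v = any? (λ k → (v F.≟ proj₁ (M i k)) ⊎-dec (v F.≟ proj₂ (M i k)))

-- deg_{M'}(v) where M' = {M_(s+1), ..., M_t} (the matchings with 0-based
-- index ≥ s): number of matchings of M' that match v
degFrom : ∀ {n r t} → Matchings n r t → ℕ → Fin n → ℕ
degFrom M s v = countFin (λ i → does ((s ℕ.≤? toℕ i) ×-dec matchedBy? M i v))

ℕ→ℚ : ℕ → ℚ
ℕ→ℚ m = + m ℚ./ 1

_^ℚ_ : ℚ → ℕ → ℚ
a ^ℚ zero  = 1ℚ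
a ^ℚ suc m = a ℚ.* (a ^ℚ m)

-- For b ≥ 0 and q > 0:  a ≤ b * 2^(p/q)   (real exponent p/q), expressed
-- exactly via  a ≤ 0  or  a^q ≤ b^q * 2^p  (valid since y ↦ y^q is strictly
-- increasing on nonnegative rationals/reals).
LeTimesPow2 : ℚ → ℚ → ℕ → ℕ → Set
LeTimesPow2 a b p q = a ℚ.≤ 0ℚ ⊎ (a ^ℚ q) ℚ.≤ (b ^ℚ q) ℚ.* (ℕ→ℚ 2 ^ℚ p)

-- For c = ↥c/↧c > 0 and t > 0, the exponent x = 4n/(ct) equals
-- (4 · n · ↧c) / (|↥c| · t).
xNum : ℕ → ℚ → ℕ
xNum n c = 4 ℕ.* n ℕ.* (↧ₙ c)

xDen : ℚ → ℕ → ℕ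
xDen c t = ℤ.∣ ↥ c ∣ ℕ.* t

{-# OPTIONS --safe #-}

-- Let 𝓜 and 𝓜′ be the first and second half of the matchings and N(v) the neighbourhood of v in the
-- graph of 𝓜, so that |N(v)| ≤ t/2 and Σ_v |N(v)| ≥ rt.  The hypothesis on deg_𝓜′ then gives
-- Σ_{M ∈ 𝓜′} Σ_{v ∈ V(M)} |N(v)| ≥ δct · rt = δc²t²n.  Choose vertices q₁, …, q_s, s ≈ n/t, greedily, each
-- maximising the growth of Σ_{M ∈ 𝓜′} |Z_M|, where Z_M is the union of the N(qᵢ) with qᵢ ∈ V(M): since every
-- vertex lies in at most t/2 of the sets N(v), each step adds Ω(δc²t²) until the sum reaches Ω(δc²tn), and
-- then at least δc²t/8 matchings M have |Z_M| > δc²n/2.  Split these according to which qᵢ they match: some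
-- class keeps a 2^(-s) fraction of them, and all its members share the same Z.  Inducedness of M ∈ 𝓜′ says
-- that V(M) is disjoint from N(q) for every q ∈ V(M), so the class avoids Z and is an ORS graph on the
-- vertices outside Z.

module Submission where

open import Defs
open import Data.Nat as ℕ using (ℕ)
open import Data.Nat.Divisibility using (_∣_)
open import Data.Nat.DivMod using (_/_)
open import Data.Integer using (+_)
open import Relation.Binary.PropositionalEquality using (_≡_)
open import Data.Rational as ℚ using (ℚ; 0ℚ; 1ℚ)
open import Data.Fin using (Fin)
open import Data.Product using (Σ; _×_; proj₁)

import Data.Nat.Properties as ℕP
open import Algebra.Properties.Semiring.Sum ℕP.+-*-semiring
  using (sum; sum-syntax; sum-cong-≗; ∑-distrib-+; ∑-comm; *-distribˡ-sum; *-distribʳ-sum)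
open import Data.Bool as Bool using (Bool; true; false; T; _∧_; _∨_; not)
open import Data.Bool.ListAction using (any)
open import Data.Bool.Properties using (T-∧; T-∨; ∧-idem)
open import Data.Empty using (⊥-elim)
open import Data.Fin as F using (toℕ; _↑ˡ_; _↑ʳ_)
open import Data.Fin.Properties as FP using (any?; injective⇒≤)
import Data.Integer as ℤ
import Data.Integer.Properties as ℤP
open import Data.List using (List; []; _∷_; length)
open import Data.List.Relation.Unary.All using (All; []; _∷_)
open import Data.Nat using (zero; suc; pred; _+_; _*_; _^_; _∸_; _≤_; _<_; _≤?_; _<?_; z≤n; s≤s; NonZero; >-nonZero)
import Data.Nat.DivMod as DM
open import Data.Nat.Solver using (module +-*-Solver)
open +-*-Solver using (solve; _:+_; _:*_; _:=_; con)
open import Data.Product using (∃; _,_; proj₂; map; map₂)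
import Data.Rational.Properties as ℚP
import Data.Rational.Unnormalised as ℚᵘ
import Data.Rational.Unnormalised.Properties as ℚᵘP
open import Data.Sum using (_⊎_; inj₁; inj₂; [_,_]′)
open import Function using (_∘_; Injective)
open import Function.Bundles using (module Equivalence)
open import Relation.Binary.Core using (_Preserves_⟶_)
open import Relation.Binary.Definitions using (tri<; tri≈; tri>)
open import Relation.Binary.PropositionalEquality
  using (refl; sym; trans; cong; cong₂; subst; subst₂; _≢_; module ≡-Reasoning)
open import Relation.Nullary using (¬_; Dec; yes; no; does)
open import Relation.Nullary.Decidable using (_×-dec_; _⊎-dec_; dec-true; dec-false)

-- Counting subsets of Fin

T-does⁺ : ∀ {A : Set} (a? : Dec A) → A → T (does a?)
T-does⁺ (yes _) _ = _
T-does⁺ (no ¬a) a = ¬a a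

T-does⁻ : ∀ {A : Set} (a? : Dec A) → T (does a?) → A
T-does⁻ (yes a) _ = a

T-not⁺ : ∀ {x} → ¬ T x → T (not x)
T-not⁺ {false} _  = _
T-not⁺ {true}  ¬x = ¬x _

𝟙 : Bool → ℕ
𝟙 true  = 1
𝟙 false = 0

𝟙-mono : ∀ {x y} → (T x → T y) → 𝟙 x ≤ 𝟙 y
𝟙-mono {false}         _   = z≤n
𝟙-mono {true} {true}   _   = ℕP.≤-refl
𝟙-mono {true} {false}  x⇒y = ⊥-elim (x⇒y _)

𝟙-split : ∀ x y → 𝟙 x ≡ 𝟙 (x ∧ y) + 𝟙 (x ∧ not y)
𝟙-split true  true  = refl
𝟙-split true  false = refl
𝟙-split false _     = refl

sum-mono-≤ : ∀ {m} {f g : Fin m → ℕ} → (∀ i → f i ≤ g i) → sum f ≤ sum g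
sum-mono-≤ {zero}  f≤g = z≤n
sum-mono-≤ {suc m} f≤g = ℕP.+-mono-≤ (f≤g F.zero) (sum-mono-≤ (f≤g ∘ F.suc))

sum-const : ∀ m k → ∑[ i < m ] k ≡ m * k
sum-const zero    k = refl
sum-const (suc m) k = cong (_+_ k) (sum-const m k)

sum≤size*max : ∀ {m} (f : Fin m → ℕ) → 0 < m → ∃ λ i → sum f ≤ m * f i
sum≤size*max {suc zero}    f _ = F.zero , ℕP.≤-refl
sum≤size*max {suc (suc m)} f _ with sum≤size*max (f ∘ F.suc) (s≤s z≤n)
... | j , sum≤ with ℕP.≤-total (f F.zero) (f (F.suc j))
...   | inj₁ f0≤fj = F.suc j , ℕP.+-mono-≤ f0≤fj sum≤
...   | inj₂ fj≤f0 = F.zero , ℕP.+-monoʳ-≤ (f F.zero) (ℕP.≤-trans sum≤ (ℕP.*-monoʳ-≤ (suc m) fj≤f0))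

countFin-sum : ∀ {m} (P : Fin m → Bool) → countFin P ≡ ∑[ i < m ] 𝟙 (P i)
countFin-sum {zero}  P = refl
countFin-sum {suc m} P with P F.zero
... | true  = cong suc (countFin-sum (P ∘ F.suc))
... | false = countFin-sum (P ∘ F.suc)

countFin-cong : ∀ {m} {P Q : Fin m → Bool} → (∀ i → P i ≡ Q i) → countFin P ≡ countFin Q
countFin-cong {P = P} {Q} P≗Q = begin
  countFin P  ≡⟨ countFin-sum P ⟩
  sum (𝟙 ∘ P) ≡⟨ sum-cong-≗ (cong 𝟙 ∘ P≗Q) ⟩
  sum (𝟙 ∘ Q) ≡⟨ countFin-sum Q ⟨
  countFin Q  ∎
  where open ≡-Reasoning

countFin-mono : ∀ {m} {P Q : Fin m → Bool} → (∀ i → T (P i) → T (Q i)) → countFin P ≤ countFin Q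
countFin-mono {P = P} {Q} P⇒Q =
  subst₂ _≤_ (sym (countFin-sum P)) (sym (countFin-sum Q)) (sum-mono-≤ (𝟙-mono ∘ P⇒Q))

countFin-false : ∀ m → countFin {m} (λ _ → false) ≡ 0
countFin-false zero    = refl
countFin-false (suc m) = countFin-false m

countFin-true : ∀ m → countFin {m} (λ _ → true) ≡ m
countFin-true zero    = refl
countFin-true (suc m) = cong suc (countFin-true m)

countFin≤ : ∀ {m} (P : Fin m → Bool) → countFin P ≤ m
countFin≤ {m} P = subst (countFin P ≤_) (countFin-true m) (countFin-mono {m} {P} {λ _ → true} (λ _ _ → _))

countFin-split : ∀ {m} (P Q : Fin m → Bool) →
                 countFin P ≡ countFin (λ i → P i ∧ Q i) + countFin (λ i → P i ∧ not (Q i))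
countFin-split {m} P Q = begin
  countFin P                          ≡⟨ countFin-sum P ⟩
  sum (λ i → 𝟙 (P i))                 ≡⟨ sum-cong-≗ (λ i → 𝟙-split (P i) (Q i)) ⟩
  sum (λ i → 𝟙 (both i) + 𝟙 (only i)) ≡⟨ ∑-distrib-+ (𝟙 ∘ both) (𝟙 ∘ only) ⟩
  sum (𝟙 ∘ both) + sum (𝟙 ∘ only)     ≡⟨ cong₂ _+_ (countFin-sum both) (countFin-sum only) ⟨
  countFin both + countFin only       ∎
  where
  open ≡-Reasoning
  both only : Fin m → Bool
  both i = P i ∧ Q i
  only i = P i ∧ not (Q i)

countFin-∧ˡ : ∀ {m} b (P : Fin m → Bool) → countFin (λ i → b ∧ P i) ≡ 𝟙 b * countFin P
countFin-∧ˡ {m} false P = countFin-false m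
countFin-∧ˡ     true  P = sym (ℕP.+-identityʳ (countFin P))

countFin-↑ˡ-↑ʳ : ∀ {m k} (P : Fin (m + k) → Bool) →
                 countFin P ≡ countFin (P ∘ (_↑ˡ k)) + countFin (P ∘ (m ↑ʳ_))
countFin-↑ˡ-↑ʳ {zero}  P = refl
countFin-↑ˡ-↑ʳ {suc m} P with P F.zero
... | true  = cong suc (countFin-↑ˡ-↑ʳ {m} (P ∘ F.suc))
... | false = countFin-↑ˡ-↑ʳ {m} (P ∘ F.suc)

countFin-witness : ∀ {m} (P : Fin m → Bool) → 0 < countFin P → ∃ λ i → T (P i)
countFin-witness {suc m} P 0<count with P F.zero in P0
... | true  = F.zero , subst T (sym P0) _
... | false with countFin-witness (P ∘ F.suc) 0<count
...   | i , Pi = F.suc i , Pi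

∑-countFin-comm : ∀ {m k} (R : Fin m → Fin k → Bool) →
                  ∑[ i < m ] countFin (R i) ≡ ∑[ j < k ] countFin (λ i → R i j)
∑-countFin-comm {m} {k} R = begin
  ∑[ i < m ] countFin (R i)         ≡⟨ sum-cong-≗ (countFin-sum ∘ R) ⟩
  ∑[ i < m ] ∑[ j < k ] 𝟙 (R i j)   ≡⟨ ∑-comm (λ i j → 𝟙 (R i j)) ⟩
  ∑[ j < k ] ∑[ i < m ] 𝟙 (R i j)   ≡⟨ sum-cong-≗ (λ j → countFin-sum (λ i → R i j)) ⟨
  ∑[ j < k ] countFin (λ i → R i j) ∎
  where open ≡-Reasoning

sum≤-by-threshold : ∀ {m} (f : Fin m → ℕ) {B} θ → (∀ i → f i ≤ B) →
                    sum f ≤ B * countFin (λ i → does (θ <? f i)) + m * θ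
sum≤-by-threshold {m} f {B} θ f≤B = begin
  sum f                                       ≤⟨ sum-mono-≤ split ⟩
  ∑[ i < m ] (B * 𝟙 (large i) + θ)            ≡⟨ ∑-distrib-+ (λ i → B * 𝟙 (large i)) (λ _ → θ) ⟩
  ∑[ i < m ] (B * 𝟙 (large i)) + ∑[ i < m ] θ ≡⟨ cong₂ _+_ (*-distribˡ-sum B (𝟙 ∘ large)) (sym (sum-const m θ)) ⟨
  B * sum (𝟙 ∘ large) + m * θ                 ≡⟨ cong (λ c → B * c + m * θ) (countFin-sum large) ⟨
  B * countFin large + m * θ                  ∎
  where
  open ℕP.≤-Reasoning
  large : Fin m → Bool
  large i = does (θ <? f i)
  split : ∀ i → f i ≤ B * 𝟙 (large i) + θ
  split i = below-or-counted (θ <? f i) (f≤B i)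
    where
    below-or-counted : ∀ {x} (d : Dec (θ < x)) → x ≤ B → x ≤ B * 𝟙 (does d) + θ
    below-or-counted (yes _)   x≤B = ℕP.≤-trans (subst (_ ≤_) (sym (ℕP.*-identityʳ B)) x≤B) (ℕP.m≤m+n (B * 1) θ)
    below-or-counted (no  x≯θ) _   = ℕP.≤-trans (ℕP.≮⇒≥ x≯θ) (ℕP.m≤n+m θ _)

-- Enumerating a subset of Fin

<-preserving⇒injective : ∀ {a b} {f : Fin a → Fin b} → f Preserves F._<_ ⟶ F._<_ → Injective _≡_ _≡_ f
<-preserving⇒injective f-mono {i} {j} fi≡fj with FP.<-cmp i j
... | tri< i<j _ _ = ⊥-elim (FP.<-irrefl fi≡fj (f-mono i<j))
... | tri≈ _ i≡j _ = i≡j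
... | tri> _ _ j<i = ⊥-elim (FP.<-irrefl (sym fi≡fj) (f-mono j<i))

record Enumeration {m} (P : Fin m → Bool) (size : ℕ) : Set where
  field
    index      : Fin size → Fin m
    increasing : index Preserves F._<_ ⟶ F._<_
    sound      : ∀ i → T (P (index i))
    complete   : ∀ x → T (P x) → ∃ λ i → index i ≡ x

  injective : Injective _≡_ _≡_ index
  injective = <-preserving⇒injective increasing

enumerate : ∀ {m} (P : Fin m → Bool) → Enumeration P (countFin P)
enumerate {zero} P = record { index = λ () ; increasing = λ { {()} } ; sound = λ () ; complete = λ () }
enumerate {suc m} P with P F.zero in P0
... | true = record { index = index′ ; increasing = increasing′ ; sound = sound′ ; complete = complete′ }
  where
  open Enumeration (enumerate (P ∘ F.suc))
  index′ : Fin (suc (countFin (P ∘ F.suc))) → Fin (suc m)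
  index′ F.zero    = F.zero
  index′ (F.suc i) = F.suc (index i)
  increasing′ : index′ Preserves F._<_ ⟶ F._<_
  increasing′ {F.zero}  {F.suc _} _         = s≤s z≤n
  increasing′ {F.suc _} {F.suc _} (s≤s i<j) = s≤s (increasing i<j)
  sound′ : ∀ i → T (P (index′ i))
  sound′ F.zero    = subst T (sym P0) _
  sound′ (F.suc i) = sound i
  complete′ : ∀ x → T (P x) → ∃ λ i → index′ i ≡ x
  complete′ F.zero    _  = F.zero , refl
  complete′ (F.suc x) Px = map F.suc (cong F.suc) (complete x Px)
... | false = record { index = F.suc ∘ index ; increasing = s≤s ∘ increasing ; sound = sound ; complete = complete′ }
  where
  open Enumeration (enumerate (P ∘ F.suc))
  complete′ : ∀ x → T (P x) → ∃ λ i → F.suc (index i) ≡ x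
  complete′ F.zero    P0true = ⊥-elim (subst T P0 P0true)
  complete′ (F.suc x) Px     = map₂ (cong F.suc) (complete x Px)

countFin≤-by-injection : ∀ {a b} {P : Fin a → Bool} (f : ∀ x → T (P x) → Fin b) →
                         (∀ {x y} Px Py → f x Px ≡ f y Py → x ≡ y) → countFin P ≤ b
countFin≤-by-injection {P = P} f f-injective =
  injective⇒≤ (λ fi≡fj → injective (f-injective (sound _) (sound _) fi≡fj))
  where open Enumeration (enumerate P)

countFin-mono-by-injection : ∀ {a b} {P : Fin a → Bool} {Q : Fin b → Bool} (f : ∀ x → T (P x) → Fin b) →
                             (∀ x Px → T (Q (f x Px))) → (∀ {x y} Px Py → f x Px ≡ f y Py → x ≡ y) →
                             countFin P ≤ countFin Q
countFin-mono-by-injection {P = P} {Q} f f-in-Q f-injective =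
  countFin≤-by-injection position λ Px Py same-position →
    f-injective Px Py (trans (sym (proj₂ (preimage _ Px))) (trans (cong index same-position) (proj₂ (preimage _ Py))))
  where
  open Enumeration (enumerate Q)
  preimage : ∀ x Px → ∃ λ i → index i ≡ f x Px
  preimage x Px = complete (f x Px) (f-in-Q x Px)
  position : ∀ x → T (P x) → Fin (countFin Q)
  position x Px = proj₁ (preimage x Px)

-- Greedy selection and pigeonhole

module _ {A : Set} (f : List A → ℕ) {goal step : ℕ}
         (extend : ∀ Q → f Q < goal → ∃ λ x → f Q + step ≤ f (x ∷ Q)) where

  greedy-progress : ∀ k → ∃ λ Q → length Q ≤ k × (goal ≤ f Q ⊎ k * step ≤ f Q)
  greedy-progress zero    = [] , z≤n , inj₂ z≤n
  greedy-progress (suc k) with greedy-progress k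
  ... | Q , |Q|≤k , inj₁ reached = Q , ℕP.m≤n⇒m≤1+n |Q|≤k , inj₁ reached
  ... | Q , |Q|≤k , inj₂ grown with goal ≤? f Q
  ...   | yes reached = Q , ℕP.m≤n⇒m≤1+n |Q|≤k , inj₁ reached
  ...   | no  short with x , grows ← extend Q (ℕP.≰⇒> short) = x ∷ Q , s≤s |Q|≤k , inj₂ (begin
    suc k * step    ≡⟨ ℕP.+-comm step (k * step) ⟩
    k * step + step ≤⟨ ℕP.+-monoˡ-≤ step grown ⟩
    f Q + step      ≤⟨ grows ⟩
    f (x ∷ Q)       ∎)
    where open ℕP.≤-Reasoning

  greedy : ∀ k → goal ≤ k * step → ∃ λ Q → length Q ≤ k × goal ≤ f Q
  greedy k goal≤ with greedy-progress k
  ... | Q , |Q|≤k , inj₁ reached = Q , |Q|≤k , reached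
  ... | Q , |Q|≤k , inj₂ grown   = Q , |Q|≤k , ℕP.≤-trans goal≤ grown

majority : ∀ {m} (P g : Fin m → Bool) → ∃ λ b → countFin P ≤ 2 * countFin (λ i → P i ∧ does (g i Bool.≟ b))
majority P g =
  [ (λ B≤A → true  , bound (ℕP.+-monoʳ-≤ A B≤A) (countFin-cong (λ i → cong (P i ∧_) (≟-true (g i)))))
  , (λ A≤B → false , bound (ℕP.+-monoˡ-≤ B A≤B) (countFin-cong (λ i → cong (P i ∧_) (≟-false (g i)))))
  ]′ (ℕP.≤-total B A)
  where
  A B : ℕ
  A = countFin (λ i → P i ∧ g i)
  B = countFin (λ i → P i ∧ not (g i))
  bound : ∀ {x y} → A + B ≤ x + x → x ≡ y → countFin P ≤ 2 * y
  bound {x} A+B≤x+x refl = subst₂ _≤_ (sym (countFin-split P g)) (cong (_+_ x) (sym (ℕP.+-identityʳ x))) A+B≤x+x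
  ≟-true : ∀ x → x ≡ does (x Bool.≟ true)
  ≟-true true  = refl
  ≟-true false = refl
  ≟-false : ∀ x → not x ≡ does (x Bool.≟ false)
  ≟-false true  = refl
  ≟-false false = refl

pigeonhole-pattern : ∀ {A : Set} {m} (test : A → Fin m → Bool) (Q : List A) (P : Fin m → Bool) →
  ∃ λ P′ → countFin P ≤ 2 ^ length Q * countFin P′ × (∀ i → T (P′ i) → T (P i)) ×
           (∀ {i i′} → T (P′ i) → T (P′ i′) → All (λ q → test q i ≡ test q i′) Q)
pigeonhole-pattern test []      P = P , ℕP.≤-reflexive (sym (ℕP.+-identityʳ _)) , (λ _ Pi → Pi) , λ _ _ → []
pigeonhole-pattern test (q ∷ Q) P
  with b , P≤2P₁ ← majority P (test q)
  with P′ , P₁≤P′ , P′⊆P₁ , same-pattern ← pigeonhole-pattern test Q (λ i → P i ∧ does (test q i Bool.≟ b))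
  = P′ , bound , (λ i → proj₁ ∘ Equivalence.to T-∧ ∘ P′⊆P₁ i) ,
    λ P′i P′i′ → trans (agrees P′i) (sym (agrees P′i′)) ∷ same-pattern P′i P′i′
  where
  agrees : ∀ {i} → T (P′ i) → test q i ≡ b
  agrees {i} P′i = T-does⁻ (test q i Bool.≟ b) (proj₂ (Equivalence.to T-∧ (P′⊆P₁ i P′i)))
  bound : countFin P ≤ 2 ^ suc (length Q) * countFin P′
  bound = begin
    countFin P                                          ≤⟨ P≤2P₁ ⟩
    2 * countFin (λ i → P i ∧ does (test q i Bool.≟ b)) ≤⟨ ℕP.*-monoʳ-≤ 2 P₁≤P′ ⟩
    2 * (2 ^ length Q * countFin P′)                    ≡⟨ ℕP.*-assoc 2 (2 ^ length Q) (countFin P′) ⟨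
    2 ^ suc (length Q) * countFin P′                    ∎
    where open ℕP.≤-Reasoning

-- Matchings, and restrictions of ORS graphs

SameEdge-sym : ∀ {n} {e f : Edge n} → SameEdge e f → SameEdge f e
SameEdge-sym (inj₁ (p , q)) = inj₁ (sym p , sym q)
SameEdge-sym (inj₂ (p , q)) = inj₂ (sym q , sym p)

SameEdge-trans : ∀ {n} {e f g : Edge n} → SameEdge e f → SameEdge f g → SameEdge e g
SameEdge-trans (inj₁ (a , b)) (inj₁ (c , d)) = inj₁ (trans a c , trans b d)
SameEdge-trans (inj₁ (a , b)) (inj₂ (c , d)) = inj₂ (trans a c , trans b d)
SameEdge-trans (inj₂ (a , b)) (inj₁ (c , d)) = inj₂ (trans a d , trans b c)
SameEdge-trans (inj₂ (a , b)) (inj₂ (c , d)) = inj₁ (trans a d , trans b c)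

sameEdge? : ∀ {n} (e f : Edge n) → Dec (SameEdge e f)
sameEdge? (u , v) (x , y) = ((u F.≟ x) ×-dec (v F.≟ y)) ⊎-dec ((u F.≟ y) ×-dec (v F.≟ x))

SameEdge⇒IsEndpoint : ∀ {n} {v w : Fin n} {e} → SameEdge (v , w) e → IsEndpoint v e
SameEdge⇒IsEndpoint (inj₁ (p , _)) = inj₁ p
SameEdge⇒IsEndpoint (inj₂ (p , _)) = inj₂ p

IsEndpoint⇒SameEdge : ∀ {n} {v : Fin n} {e} → IsEndpoint v e → ∃ λ w → SameEdge (v , w) e
IsEndpoint⇒SameEdge {e = _ , w} (inj₁ p) = w , inj₁ (p , refl)
IsEndpoint⇒SameEdge {e = w , _} (inj₂ p) = w , inj₂ (p , refl)

common-endpoint⇒ShareVertex : ∀ {n} {v : Fin n} {e f} → IsEndpoint v e → IsEndpoint v f → ShareVertex e f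
common-endpoint⇒ShareVertex {f = f} (inj₁ p) v∈f = inj₁ (subst (λ x → IsEndpoint x f) p v∈f)
common-endpoint⇒ShareVertex {f = f} (inj₂ p) v∈f = inj₂ (subst (λ x → IsEndpoint x f) p v∈f)

SameEdge-endpoints : ∀ {n} {X : Fin n → Set} {v w e} → SameEdge (v , w) e → X v → X w → X (proj₁ e) × X (proj₂ e)
SameEdge-endpoints {X = X} (inj₁ (p , q)) Xv Xw = subst X p Xv , subst X q Xw
SameEdge-endpoints {X = X} (inj₂ (p , q)) Xv Xw = subst X q Xw , subst X p Xv

other-endpoint-unique : ∀ {n} {v w w′ : Fin n} {e} → proj₁ e ≢ proj₂ e →
                        SameEdge (v , w) e → SameEdge (v , w′) e → w ≡ w′
other-endpoint-unique _     (inj₁ (_ , p)) (inj₁ (_ , q)) = trans p (sym q)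
other-endpoint-unique loopl (inj₁ (p , _)) (inj₂ (q , _)) = ⊥-elim (loopl (trans (sym p) q))
other-endpoint-unique loopl (inj₂ (p , _)) (inj₁ (q , _)) = ⊥-elim (loopl (trans (sym q) p))
other-endpoint-unique _     (inj₂ (_ , p)) (inj₂ (_ , q)) = trans p (sym q)

matched : ∀ {n r t} → Matchings n r t → Fin t → Fin n → Bool
matched M i v = does (matchedBy? M i v)

matched⁺ : ∀ {n r t} {M : Matchings n r t} {i v} → MatchedBy M i v → T (matched M i v)
matched⁺ {M = M} {i} {v} = T-does⁺ (matchedBy? M i v)

matched⁻ : ∀ {n r t} {M : Matchings n r t} {i v} → T (matched M i v) → MatchedBy M i v
matched⁻ {M = M} {i} {v} = T-does⁻ (matchedBy? M i v)

module _ {n r t} {M : Matchings n r t} (ors : IsORS M) where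
  open IsORS ors

  ShareVertex⇒same-edge : ∀ {i k k′} → ShareVertex (M i k) (M i k′) → k ≡ k′
  ShareVertex⇒same-edge {i} {k} {k′} shared with k F.≟ k′
  ... | yes k≡k′ = k≡k′
  ... | no  k≢k′ = ⊥-elim (matching i k k′ k≢k′ shared)

  partner-unique : ∀ {i k k′ v w w′} → SameEdge (v , w) (M i k) → SameEdge (v , w′) (M i k′) → w ≡ w′
  partner-unique {i} {k} vw∈k vw′∈k′
    with refl ← ShareVertex⇒same-edge (common-endpoint⇒ShareVertex (SameEdge⇒IsEndpoint vw∈k) (SameEdge⇒IsEndpoint vw′∈k′))
    = other-endpoint-unique (loopless i k) vw∈k vw′∈k′

  edge-in-unique-matching : ∀ {e i j k k′} → SameEdge e (M i k) → SameEdge e (M j k′) → i ≡ j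
  edge-in-unique-matching {i = i} {j} {k} {k′} e∈i e∈j with i F.≟ j
  ... | yes i≡j = i≡j
  ... | no  i≢j = ⊥-elim (edgeDisjoint i j k k′ i≢j (SameEdge-trans (SameEdge-sym e∈i) e∈j))

  r+r≤countFin-matched : ∀ i → r + r ≤ countFin (λ v → matched M i v)
  r+r≤countFin-matched i = subst (_≤ countFin (λ v → matched M i v)) (countFin-true (r + r))
    (countFin-mono-by-injection {P = λ _ → true} {λ v → matched M i v} (λ x _ → endpoint (F.splitAt r x))
      (λ x _ → matched⁺ {M = M} (endpoint-matched (F.splitAt r x)))
      (λ {x} {y} _ _ same → begin
        x                          ≡⟨ FP.join-splitAt r r x ⟨
        F.join r r (F.splitAt r x) ≡⟨ cong (F.join r r) (endpoint-injective (F.splitAt r x) (F.splitAt r y) same) ⟩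
        F.join r r (F.splitAt r y) ≡⟨ FP.join-splitAt r r y ⟩
        y                          ∎))
    where
    open ≡-Reasoning
    endpoint : Fin r ⊎ Fin r → Fin n
    endpoint (inj₁ k) = proj₁ (M i k)
    endpoint (inj₂ k) = proj₂ (M i k)
    endpoint-matched : ∀ s → MatchedBy M i (endpoint s)
    endpoint-matched (inj₁ k) = k , inj₁ refl
    endpoint-matched (inj₂ k) = k , inj₂ refl
    endpoint-injective : ∀ s s′ → endpoint s ≡ endpoint s′ → s ≡ s′
    endpoint-injective (inj₁ k) (inj₁ k′) eq = cong inj₁ (ShareVertex⇒same-edge (inj₁ (inj₁ eq)))
    endpoint-injective (inj₁ k) (inj₂ k′) eq with refl ← ShareVertex⇒same-edge {i} {k} {k′} (inj₁ (inj₂ eq)) =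
      ⊥-elim (loopless i k eq)
    endpoint-injective (inj₂ k) (inj₁ k′) eq with refl ← ShareVertex⇒same-edge {i} {k} {k′} (inj₂ (inj₁ eq)) =
      ⊥-elim (loopless i k (sym eq))
    endpoint-injective (inj₂ k) (inj₂ k′) eq = cong inj₂ (ShareVertex⇒same-edge (inj₂ (inj₂ eq)))

  r+r≤n : Fin t → r + r ≤ n
  r+r≤n i = ℕP.≤-trans (r+r≤countFin-matched i) (countFin≤ (λ v → matched M i v))

  IsORS-∘ : ∀ {t′} (f : Fin t′ → Fin t) → f Preserves F._<_ ⟶ F._<_ → IsORS (M ∘ f)
  IsORS-∘ f f-increasing = record
    { loopless     = loopless ∘ f
    ; matching     = matching ∘ f
    ; edgeDisjoint = λ i j k k′ i≢j → edgeDisjoint (f i) (f j) k k′ (i≢j ∘ <-preserving⇒injective f-increasing)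
    ; induced      = λ i j k j<i → induced (f i) (f j) k (f-increasing j<i)
    }

MapsTo : ∀ {n′ n} → (Fin n′ → Fin n) → Edge n′ → Edge n → Set
MapsTo g e′ e = g (proj₁ e′) ≡ proj₁ e × g (proj₂ e′) ≡ proj₂ e

module _ {n′ n} {g : Fin n′ → Fin n} where

  IsEndpoint-image : ∀ {x e′ e} → MapsTo g e′ e → IsEndpoint x e′ → IsEndpoint (g x) e
  IsEndpoint-image (p , _) (inj₁ refl) = inj₁ p
  IsEndpoint-image (_ , q) (inj₂ refl) = inj₂ q

  ShareVertex-image : ∀ {e′ e f′ f} → MapsTo g e′ e → MapsTo g f′ f → ShareVertex e′ f′ → ShareVertex e f
  ShareVertex-image {f = f} (p , _) g[f′]≡f (inj₁ x) = inj₁ (subst (λ z → IsEndpoint z f) p (IsEndpoint-image g[f′]≡f x))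
  ShareVertex-image {f = f} (_ , q) g[f′]≡f (inj₂ x) = inj₂ (subst (λ z → IsEndpoint z f) q (IsEndpoint-image g[f′]≡f x))

  SameEdge-image : ∀ {e′ e f′ f} → MapsTo g e′ e → MapsTo g f′ f → SameEdge e′ f′ → SameEdge e f
  SameEdge-image (p , q) (p′ , q′) (inj₁ (a , b)) = inj₁ (trans (sym p) (trans (cong g a) p′) , trans (sym q) (trans (cong g b) q′))
  SameEdge-image (p , q) (p′ , q′) (inj₂ (a , b)) = inj₂ (trans (sym p) (trans (cong g a) q′) , trans (sym q) (trans (cong g b) p′))

  IsORS-pullback : ∀ {r t} {M′ : Matchings n′ r t} {M : Matchings n r t} →
                   (∀ i k → MapsTo g (M′ i k) (M i k)) → IsORS M → IsORS M′
  IsORS-pullback {M′ = M′} {M} maps ors = record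
    { loopless     = λ i k loop → loopless i k (trans (sym (proj₁ (maps i k))) (trans (cong g loop) (proj₂ (maps i k))))
    ; matching     = λ i k k′ k≢k′ shared → matching i k k′ k≢k′ (ShareVertex-image (maps i k) (maps i k′) shared)
    ; edgeDisjoint = λ i j k k′ i≢j same → edgeDisjoint i j k k′ i≢j (SameEdge-image (maps i k) (maps j k′) same)
    ; induced      = λ i j k j<i (m₁ , m₂) → induced i j k j<i
                       ( subst (MatchedBy M i) (proj₁ (maps j k)) (image i m₁)
                       , subst (MatchedBy M i) (proj₂ (maps j k)) (image i m₂))
    }
    where
    open IsORS ors
    image : ∀ i {x} → MatchedBy M′ i x → MatchedBy M i (g x)
    image i (k , x∈k) = k , IsEndpoint-image (maps i k) x∈k

restrict : ∀ {n r t} {M : Matchings n r t} → IsORS M → (P : Fin t → Bool) (W : Fin n → Bool) →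
           (∀ i k → T (P i) → T (W (proj₁ (M i k))) × T (W (proj₂ (M i k)))) →
           ORS (countFin W) r (countFin P)
restrict {r = r} {M = M} ors P W covers =
  M′ , IsORS-pullback {g = vertices.index} maps (IsORS-∘ ors matchings.index matchings.increasing)
  where
  module matchings = Enumeration (enumerate P)
  module vertices = Enumeration (enumerate W)
  position : ∀ v → T (W v) → Fin (countFin W)
  position v Wv = proj₁ (vertices.complete v Wv)
  M′ : Matchings (countFin W) r (countFin P)
  M′ i k = position (proj₁ (M (matchings.index i) k)) (proj₁ (covers _ k (matchings.sound i)))
         , position (proj₂ (M (matchings.index i) k)) (proj₂ (covers _ k (matchings.sound i)))
  maps : ∀ i k → MapsTo vertices.index (M′ i k) (M (matchings.index i) k)
  maps i k = proj₂ (vertices.complete _ _) , proj₂ (vertices.complete _ _)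

-- Greedy covering

-- N v is the neighbourhood of v and V i the vertex set of the i-th matching; reach Q i is the union of
-- the N q with q ∈ Q matched by the i-th matching.
module Covering {n m} (N : Fin n → Fin n → Bool) (V : Fin m → Fin n → Bool) where

  reach : List (Fin n) → Fin m → Fin n → Bool
  reach Q i w = any (λ q → V i q ∧ N q w) Q

  covered : List (Fin n) → ℕ
  covered Q = ∑[ i < m ] countFin (reach Q i)

  fresh : List (Fin n) → Fin m → Fin n → Fin n → Bool
  fresh Q i v w = (V i v ∧ N v w) ∧ not (reach Q i w)

  gain : List (Fin n) → Fin n → ℕ
  gain Q v = ∑[ i < m ] countFin (fresh Q i v)

  incidences : Fin m → ℕ
  incidences i = ∑[ v < n ] countFin (λ w → V i v ∧ N v w)

  load : ℕ
  load = ∑[ i < m ] incidences i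

  reach⁻ : ∀ Q {i w} → T (reach Q i w) → ∃ λ q → T (V i q) × T (N q w)
  reach⁻ (q ∷ Q) i∼w with Equivalence.to T-∨ i∼w
  ... | inj₁ q∼w = q , Equivalence.to T-∧ q∼w
  ... | inj₂ Q∼w = reach⁻ Q Q∼w

  reach-cong : ∀ {i i′} Q → All (λ q → V i q ≡ V i′ q) Q → ∀ w → reach Q i w ≡ reach Q i′ w
  reach-cong []      []           w = refl
  reach-cong (q ∷ Q) (i≡i′ ∷ Q≡) w = cong₂ _∨_ (cong (_∧ N q w) i≡i′) (reach-cong Q Q≡ w)

  covered-∷ : ∀ Q v → covered (v ∷ Q) ≡ covered Q + gain Q v
  covered-∷ Q v =
    trans (sum-cong-≗ split) (∑-distrib-+ (λ i → countFin (reach Q i)) (λ i → countFin (fresh Q i v)))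
    where
    ∨-∧-absorb : ∀ x z → (x ∨ z) ∧ z ≡ z
    ∨-∧-absorb true  true  = refl
    ∨-∧-absorb true  false = refl
    ∨-∧-absorb false z     = ∧-idem z
    ∨-∧-not : ∀ x z → (x ∨ z) ∧ not z ≡ x ∧ not z
    ∨-∧-not true  true  = refl
    ∨-∧-not true  false = refl
    ∨-∧-not false true  = refl
    ∨-∧-not false false = refl
    split : ∀ i → countFin (reach (v ∷ Q) i) ≡ countFin (reach Q i) + countFin (fresh Q i v)
    split i = trans (countFin-split (reach (v ∷ Q) i) (reach Q i))
      (cong₂ _+_ (countFin-cong (λ w → ∨-∧-absorb (V i v ∧ N v w) (reach Q i w)))
                 (countFin-cong (λ w → ∨-∧-not (V i v ∧ N v w) (reach Q i w))))

  module _ {d} (column≤ : ∀ w → countFin (λ v → N v w) ≤ d) where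

    incidences≤ : ∀ Q i → incidences i ≤ ∑[ v < n ] countFin (fresh Q i v) + d * countFin (reach Q i)
    incidences≤ Q i = begin
      ∑[ v < n ] countFin (a v)                                  ≡⟨ sum-cong-≗ split ⟩
      ∑[ v < n ] (countFin (fresh Q i v) + countFin (reached v)) ≡⟨ ∑-distrib-+ (countFin ∘ fresh Q i) (countFin ∘ reached) ⟩
      ∑fresh + ∑[ v < n ] countFin (reached v)                   ≡⟨ cong (_+_ ∑fresh) (∑-countFin-comm reached) ⟩
      ∑fresh + ∑[ w < n ] countFin (λ v → reached v w)           ≤⟨ ℕP.+-monoʳ-≤ ∑fresh (sum-mono-≤ reached-column≤) ⟩
      ∑fresh + ∑[ w < n ] (d * 𝟙 (Z w))                          ≡⟨ cong (_+_ ∑fresh) (*-distribˡ-sum d (𝟙 ∘ Z)) ⟨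
      ∑fresh + d * sum (𝟙 ∘ Z)                                   ≡⟨ cong (λ c → ∑fresh + d * c) (countFin-sum Z) ⟨
      ∑fresh + d * countFin Z                                    ∎
      where
      open ℕP.≤-Reasoning
      Z : Fin n → Bool
      Z = reach Q i
      a reached : Fin n → Fin n → Bool
      a v w = V i v ∧ N v w
      reached v w = a v w ∧ Z w
      ∑fresh : ℕ
      ∑fresh = ∑[ v < n ] countFin (fresh Q i v)
      split : ∀ v → countFin (a v) ≡ countFin (fresh Q i v) + countFin (reached v)
      split v = trans (countFin-split (a v) Z) (ℕP.+-comm (countFin (reached v)) (countFin (fresh Q i v)))
      reached⇒column : ∀ x y z → T ((x ∧ y) ∧ z) → T (z ∧ y)
      reached⇒column true true true _ = _
      reached-column≤ : ∀ w → countFin (λ v → reached v w) ≤ d * 𝟙 (Z w)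
      reached-column≤ w = begin
        countFin (λ v → reached v w)     ≤⟨ countFin-mono (λ v → reached⇒column (V i v) (N v w) (Z w)) ⟩
        countFin (λ v → Z w ∧ N v w)     ≡⟨ countFin-∧ˡ (Z w) (λ v → N v w) ⟩
        𝟙 (Z w) * countFin (λ v → N v w) ≤⟨ ℕP.*-monoʳ-≤ (𝟙 (Z w)) (column≤ w) ⟩
        𝟙 (Z w) * d                      ≡⟨ ℕP.*-comm (𝟙 (Z w)) d ⟩
        d * 𝟙 (Z w)                      ∎

    load≤ : ∀ Q → load ≤ ∑[ v < n ] gain Q v + d * covered Q
    load≤ Q = begin
      ∑[ i < m ] incidences i                                      ≤⟨ sum-mono-≤ (incidences≤ Q) ⟩
      ∑[ i < m ] (∑[ v < n ] #fresh i v + d * #reach i)            ≡⟨ ∑-distrib-+ (λ i → ∑[ v < n ] #fresh i v) (λ i → d * #reach i) ⟩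
      ∑[ i < m ] ∑[ v < n ] #fresh i v + ∑[ i < m ] (d * #reach i) ≡⟨ cong₂ _+_ (∑-comm (λ v i → #fresh i v)) (*-distribˡ-sum d #reach) ⟨
      ∑[ v < n ] gain Q v + d * covered Q                          ∎
      where
      open ℕP.≤-Reasoning
      #fresh : Fin m → Fin n → ℕ
      #fresh i v = countFin (fresh Q i v)
      #reach : Fin m → ℕ
      #reach i = countFin (reach Q i)

    vertex-with-large-gain : 0 < n → ∀ Q → ∃ λ v → load ≤ n * gain Q v + d * covered Q
    vertex-with-large-gain 0<n Q with v , ∑gain≤ ← sum≤size*max (gain Q) 0<n =
      v , ℕP.≤-trans (load≤ Q) (ℕP.+-monoˡ-≤ (d * covered Q) ∑gain≤)

  load-lower-bound : ∀ {α β} → (∀ v → α ≤ β * countFin (λ i → V i v)) →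
                     α * ∑[ v < n ] countFin (N v) ≤ β * load
  load-lower-bound {α} {β} α≤βdeg = begin
    α * ∑[ v < n ] deg v                              ≡⟨ *-distribˡ-sum α deg ⟩
    ∑[ v < n ] (α * deg v)                            ≤⟨ sum-mono-≤ (λ v → ℕP.*-monoˡ-≤ (deg v) (α≤βdeg v)) ⟩
    ∑[ v < n ] (β * countFin (λ i → V i v) * deg v)   ≡⟨ sum-cong-≗ (λ v → ℕP.*-assoc β _ (deg v)) ⟩
    ∑[ v < n ] (β * (countFin (λ i → V i v) * deg v)) ≡⟨ *-distribˡ-sum β (λ v → countFin (λ i → V i v) * deg v) ⟨
    β * ∑[ v < n ] (countFin (λ i → V i v) * deg v)   ≡⟨ cong (β *_) (sum-cong-≗ multiplicity) ⟩
    β * ∑[ v < n ] ∑[ i < m ] (𝟙 (V i v) * deg v)     ≡⟨ cong (β *_) (∑-comm (λ i v → 𝟙 (V i v) * deg v)) ⟨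
    β * ∑[ i < m ] ∑[ v < n ] (𝟙 (V i v) * deg v)     ≡⟨ cong (β *_) (sum-cong-≗ (λ i → sum-cong-≗ (λ v → countFin-∧ˡ (V i v) (N v)))) ⟨
    β * load                                          ∎
    where
    open ℕP.≤-Reasoning
    deg : Fin n → ℕ
    deg v = countFin (N v)
    multiplicity : ∀ v → countFin (λ i → V i v) * deg v ≡ ∑[ i < m ] (𝟙 (V i v) * deg v)
    multiplicity v = trans (cong (_* deg v) (countFin-sum (λ i → V i v))) (*-distribʳ-sum (deg v) (λ i → 𝟙 (V i v)))

-- The two halves of an ORS graph

module Halves {n r h} {M : Matchings n r (h + h)} (ors : IsORS M) where
  open IsORS ors

  early late : Matchings n r h
  early j = M (j ↑ˡ h)
  late  i = M (h ↑ʳ i)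

  Adjacent : Fin n → Fin n → Set
  Adjacent v w = ∃ λ j → ∃ λ k → SameEdge (v , w) (early j k)

  adjacent? : ∀ v w → Dec (Adjacent v w)
  adjacent? v w = any? λ j → any? λ k → sameEdge? (v , w) (early j k)

  adjacent : Fin n → Fin n → Bool
  adjacent v w = does (adjacent? v w)

  adjacent-sym : ∀ {v w} → T (adjacent v w) → T (adjacent w v)
  adjacent-sym {v} {w} vw with j , k , vw∈k ← T-does⁻ (adjacent? v w) vw =
    T-does⁺ (adjacent? w v) (j , k , SameEdge-trans (inj₂ (refl , refl)) vw∈k)

  degree≤h : ∀ v → countFin (adjacent v) ≤ h
  degree≤h v = countFin≤-by-injection (λ w vw → proj₁ (T-does⁻ (adjacent? v w) vw))
    (λ {w} {w′} vw vw′ → same-matching⇒same-neighbour (T-does⁻ (adjacent? v w) vw) (T-does⁻ (adjacent? v w′) vw′))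
    where
    same-matching⇒same-neighbour : ∀ {w w′} (a : Adjacent v w) (a′ : Adjacent v w′) → proj₁ a ≡ proj₁ a′ → w ≡ w′
    same-matching⇒same-neighbour (_ , _ , vw∈k) (_ , _ , vw′∈k′) refl = partner-unique ors vw∈k vw′∈k′

  early-degree≤degree : ∀ v → countFin (λ j → matched early j v) ≤ countFin (adjacent v)
  early-degree≤degree v = countFin-mono-by-injection (λ j vj → proj₁ (partner j vj))
    (λ j vj → T-does⁺ (adjacent? v _) (j , proj₂ (partner j vj)))
    (λ {j} {j′} vj vj′ → same-neighbour⇒same-matching (partner j vj) (partner j′ vj′))
    where
    Partner : Fin h → Set
    Partner j = ∃ λ w → ∃ λ k → SameEdge (v , w) (early j k)
    partner : ∀ j → T (matched early j v) → Partner j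
    partner j vj = let k , v∈k = matched⁻ {M = early} vj
                       w , vw∈k = IsEndpoint⇒SameEdge v∈k
                   in w , k , vw∈k
    same-neighbour⇒same-matching : ∀ {j j′} (a : Partner j) (a′ : Partner j′) → proj₁ a ≡ proj₁ a′ → j ≡ j′
    same-neighbour⇒same-matching (_ , _ , vw∈k) (_ , _ , vw∈k′) refl =
      FP.↑ˡ-injective h _ _ (edge-in-unique-matching ors vw∈k vw∈k′)

  early-edges≤degree-sum : h * (r + r) ≤ ∑[ v < n ] countFin (adjacent v)
  early-edges≤degree-sum = begin
    h * (r + r)                                   ≡⟨ sum-const h (r + r) ⟨
    ∑[ j < h ] (r + r)                            ≤⟨ sum-mono-≤ (λ j → r+r≤countFin-matched ors (j ↑ˡ h)) ⟩
    ∑[ j < h ] countFin (λ v → matched early j v) ≡⟨ ∑-countFin-comm (λ j v → matched early j v) ⟩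
    ∑[ v < n ] countFin (λ j → matched early j v) ≤⟨ sum-mono-≤ early-degree≤degree ⟩
    ∑[ v < n ] countFin (adjacent v)              ∎
    where open ℕP.≤-Reasoning

  degree-sum≤n*n : ∑[ v < n ] countFin (adjacent v) ≤ n * n
  degree-sum≤n*n = ℕP.≤-trans (sum-mono-≤ (countFin≤ ∘ adjacent)) (ℕP.≤-reflexive (sum-const n n))

  late-avoids-neighbours : ∀ {i q w} → T (matched late i q) → T (adjacent q w) → ¬ T (matched late i w)
  late-avoids-neighbours {i} {q} {w} iq qw iw with j , k , qw∈k ← T-does⁻ (adjacent? q w) qw =
    induced (h ↑ʳ i) (j ↑ˡ h) k early<late (SameEdge-endpoints qw∈k (matched⁻ {M = late} iq) (matched⁻ {M = late} iw))
    where
    early<late : toℕ (j ↑ˡ h) < toℕ (h ↑ʳ i)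
    early<late = subst₂ _<_ (sym (FP.toℕ-↑ˡ j h)) (sym (FP.toℕ-↑ʳ h i)) (ℕP.<-≤-trans (FP.toℕ<n j) (ℕP.m≤m+n h (toℕ i)))

  degFrom-late : ∀ v → degFrom M h v ≡ countFin (λ i → matched late i v)
  degFrom-late v = begin
    degFrom M h v                                                         ≡⟨ countFin-↑ˡ-↑ʳ {h} _ ⟩
    countFin (λ j → in-late (j ↑ˡ h)) + countFin (λ i → in-late (h ↑ʳ i)) ≡⟨ cong₂ _+_ (countFin-cong early-out) (countFin-cong late-in) ⟩
    countFin {h} (λ _ → false) + countFin (λ i → matched late i v)        ≡⟨ cong (_+ countFin (λ i → matched late i v)) (countFin-false h) ⟩
    countFin (λ i → matched late i v)                                     ∎
    where
    open ≡-Reasoning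
    in-late : Fin (h + h) → Bool
    in-late i = does (h ≤? toℕ i) ∧ matched M i v
    early-out : ∀ j → in-late (j ↑ˡ h) ≡ false
    early-out j = cong (_∧ matched M (j ↑ˡ h) v) (dec-false (h ≤? toℕ (j ↑ˡ h))
      (ℕP.<⇒≱ (subst (_< h) (sym (FP.toℕ-↑ˡ j h)) (FP.toℕ<n j))))
    late-in : ∀ i → in-late (h ↑ʳ i) ≡ matched late i v
    late-in i = cong (_∧ matched late i v) (dec-true (h ≤? toℕ (h ↑ʳ i))
      (subst (h ≤_) (sym (FP.toℕ-↑ʳ h i)) (ℕP.m≤m+n h (toℕ i))))

-- The combinatorial core

0<-factorʳ : ∀ y {z} → 0 < y * z → 0 < z
0<-factorʳ y {zero}  0<y*0 = ⊥-elim (ℕP.<-irrefl refl (subst (0 <_) (ℕP.*-zeroʳ y) 0<y*0))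
0<-factorʳ y {suc _} _     = s≤s z≤n

gain-bound : ∀ {n h U x y} → 0 < n → 32 * U * h * h * n ≤ n * x + h * y →
             y ≤ 6 * h * U * n → 26 * U * h * h ≤ x
gain-bound {n} {h} {U} {x} {y} 0<n load≤ y≤ =
  ℕP.*-cancelˡ-≤ n {{>-nonZero 0<n}} (ℕP.+-cancelʳ-≤ (h * (6 * h * U * n)) _ _ (begin
    n * (26 * U * h * h) + h * (6 * h * U * n) ≡⟨ solve 3 (λ n h U → n :* (con 26 :* U :* h :* h) :+ h :* (con 6 :* h :* U :* n)
                                                                          := con 32 :* U :* h :* h :* n) refl n h U ⟩
    32 * U * h * h * n                         ≤⟨ load≤ ⟩
    n * x + h * y                              ≤⟨ ℕP.+-monoʳ-≤ (n * x) (ℕP.*-monoʳ-≤ h y≤) ⟩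
    n * x + h * (6 * h * U * n)                ∎))
  where open ℕP.≤-Reasoning

greedy-rounds : ∀ {n h U s} → n ≤ s * (h + h) → 6 * h * U * n ≤ s * (26 * U * h * h)
greedy-rounds {n} {h} {U} {s} n≤ = begin
  6 * h * U * n             ≤⟨ ℕP.*-monoʳ-≤ (6 * h * U) n≤ ⟩
  6 * h * U * (s * (h + h)) ≡⟨ solve 3 (λ h U s → con 6 :* h :* U :* (s :* (h :+ h)) := s :* (con 12 :* U :* h :* h)) refl h U s ⟩
  s * (12 * U * h * h)      ≤⟨ ℕP.*-monoʳ-≤ s (ℕP.*-monoˡ-≤ h (ℕP.*-monoˡ-≤ h (ℕP.*-monoˡ-≤ U (ℕP.m≤m+n 12 14)))) ⟩
  s * (26 * U * h * h)      ∎
  where open ℕP.≤-Reasoning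

good-count-bound : ∀ {n h U K g} → 0 < n → 6 * h * U * n ≤ K * n * g + h * (4 * U * n) →
                   (h + h) * U ≤ K * g
good-count-bound {n} {h} {U} {K} {g} 0<n covered≤ =
  ℕP.*-cancelʳ-≤ _ _ n {{>-nonZero 0<n}} (ℕP.+-cancelʳ-≤ (h * (4 * U * n)) _ _ (begin
    (h + h) * U * n + h * (4 * U * n) ≡⟨ solve 3 (λ n h U → (h :+ h) :* U :* n :+ h :* (con 4 :* U :* n)
                                                         := con 6 :* h :* U :* n) refl n h U ⟩
    6 * h * U * n                     ≤⟨ covered≤ ⟩
    K * n * g + h * (4 * U * n)       ≡⟨ cong (_+ h * (4 * U * n)) (solve 3 (λ K n g → K :* n :* g := K :* g :* n) refl K n g) ⟩
    K * g * n + h * (4 * U * n)       ∎))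
  where open ℕP.≤-Reasoning

module _ {n r h} {M : Matchings n r (h + h)} (ors : IsORS M) where
  open Halves {h = h} ors
  open Covering adjacent (λ i v → matched late i v)

  late-ORS : IsORS late
  late-ORS = IsORS-∘ ors (h ↑ʳ_) λ {i} {j} i<j →
    subst₂ _<_ (sym (FP.toℕ-↑ʳ h i)) (sym (FP.toℕ-↑ʳ h j)) (ℕP.+-monoʳ-< h i<j)

  column≤h : ∀ w → countFin (λ v → adjacent v w) ≤ h
  column≤h w = ℕP.≤-trans (countFin-mono {Q = adjacent w} (λ v → adjacent-sym {v} {w})) (degree≤h w)

  good : ℕ → ℕ → List (Fin n) → Fin h → Bool
  good K U Q i = does (4 * U * n <? K * countFin (reach Q i))

  many-good-matchings : 0 < n → ∀ {K U} → 32 * U * h * h * n ≤ K * load →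
                        ∀ s → n ≤ s * (h + h) →
                        ∃ λ Q → length Q ≤ s × (h + h) * U ≤ K * countFin (good K U Q)
  many-good-matchings 0<n {K} {U} load≥ s n≤ =
    let Q , |Q|≤s , goal≤ = greedy (λ Q → K * covered Q) extend s (greedy-rounds {n} {h} {U} {s} n≤)
    in Q , |Q|≤s , good-count-bound {n} {h} {U} {K} 0<n (ℕP.≤-trans goal≤ (covered≤ Q))
    where
    extend : ∀ Q → K * covered Q < 6 * h * U * n →
             ∃ λ v → K * covered Q + 26 * U * h * h ≤ K * covered (v ∷ Q)
    extend Q short with v , load≤ ← vertex-with-large-gain column≤h 0<n Q =
      v , (begin
        K * covered Q + 26 * U * h * h ≤⟨ ℕP.+-monoʳ-≤ (K * covered Q) (gain-bound {n} {h} {U} 0<n Kload≤ (ℕP.<⇒≤ short)) ⟩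
        K * covered Q + K * gain Q v   ≡⟨ ℕP.*-distribˡ-+ K (covered Q) (gain Q v) ⟨
        K * (covered Q + gain Q v)     ≡⟨ cong (K *_) (covered-∷ Q v) ⟨
        K * covered (v ∷ Q)            ∎)
      where
      open ℕP.≤-Reasoning
      Kload≤ : 32 * U * h * h * n ≤ n * (K * gain Q v) + h * (K * covered Q)
      Kload≤ = ℕP.≤-trans load≥ (ℕP.≤-trans (ℕP.*-monoʳ-≤ K load≤) (ℕP.≤-reflexive
        (solve 5 (λ K n g h c → K :* (n :* g :+ h :* c) := n :* (K :* g) :+ h :* (K :* c)) refl K n (gain Q v) h (covered Q))))
    covered≤ : ∀ Q → K * covered Q ≤ K * n * countFin (good K U Q) + h * (4 * U * n)
    covered≤ Q = ℕP.≤-trans (ℕP.≤-reflexive (*-distribˡ-sum K (λ i → countFin (reach Q i))))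
      (sum≤-by-threshold (λ i → K * countFin (reach Q i)) (4 * U * n) (λ i → ℕP.*-monoʳ-≤ K (countFin≤ (reach Q i))))

  -- The matchings of one pattern class share the set reach Q i₀, which they avoid by inducedness.
  common-pattern-restriction : ∀ {K U} Q → 0 < (h + h) * U → (h + h) * U ≤ K * countFin (good K U Q) →
    ∃ λ n′ → ∃ λ t′ → ORS n′ r t′ × K * n′ + 4 * U * n < K * n × (h + h) * U ≤ K * (2 ^ length Q * t′)
  common-pattern-restriction {K} {U} Q 0<tU tU≤Kg
    with P′ , good≤ , P′⊆good , same-pattern ← pigeonhole-pattern (λ q i → matched late i q) Q (good K U Q)
    = countFin outside , countFin P′ , restrict late-ORS P′ outside covers , n′-bound , t′-bound
    where
    t′-bound : (h + h) * U ≤ K * (2 ^ length Q * countFin P′)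
    t′-bound = ℕP.≤-trans tU≤Kg (ℕP.*-monoʳ-≤ K good≤)
    0<P′ : 0 < countFin P′
    0<P′ = 0<-factorʳ (2 ^ length Q) (0<-factorʳ K (ℕP.<-≤-trans 0<tU t′-bound))
    i₀ : Fin h
    i₀ = proj₁ (countFin-witness P′ 0<P′)
    P′i₀ : T (P′ i₀)
    P′i₀ = proj₂ (countFin-witness P′ 0<P′)
    outside : Fin n → Bool
    outside w = not (reach Q i₀ w)
    late-outside : ∀ {i w} → T (P′ i) → T (matched late i w) → T (outside w)
    late-outside {i} {w} P′i iw = T-not⁺ λ i₀∼w →
      let q , iq , qw = reach⁻ Q (subst T (reach-cong Q (same-pattern P′i₀ P′i) w) i₀∼w)
      in late-avoids-neighbours iq qw iw
    covers : ∀ i k → T (P′ i) → T (outside (proj₁ (late i k))) × T (outside (proj₂ (late i k)))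
    covers i k P′i = late-outside P′i (matched⁺ {M = late} (k , inj₁ refl))
                   , late-outside P′i (matched⁺ {M = late} (k , inj₂ refl))
    n′-bound : K * countFin outside + 4 * U * n < K * n
    n′-bound = begin-strict
      K * countFin outside + 4 * U * n                 <⟨ ℕP.+-monoʳ-< (K * countFin outside) i₀-good ⟩
      K * countFin outside + K * countFin (reach Q i₀) ≡⟨ ℕP.*-distribˡ-+ K _ _ ⟨
      K * (countFin outside + countFin (reach Q i₀))   ≡⟨ cong (K *_) (ℕP.+-comm (countFin outside) _) ⟩
      K * (countFin (reach Q i₀) + countFin outside)   ≡⟨ cong (K *_) n-split ⟨
      K * n                                            ∎
      where
      open ℕP.≤-Reasoning
      i₀-good : 4 * U * n < K * countFin (reach Q i₀)
      i₀-good = T-does⁻ (4 * U * n <? K * countFin (reach Q i₀)) (P′⊆good i₀ P′i₀)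
      n-split : n ≡ countFin (reach Q i₀) + countFin outside
      n-split = trans (sym (countFin-true n)) (countFin-split (λ _ → true) (reach Q i₀))

  shrink-scaled : 0 < n → ∀ {K U} → 0 < (h + h) * U → 32 * U * h * h * n ≤ K * load →
                  ∀ s → n ≤ s * (h + h) →
                  ∃ λ n′ → ∃ λ t′ → ORS n′ r t′ × K * n′ + 4 * U * n < K * n ×
                                    (h + h) * U ≤ K * (2 ^ s * t′)
  shrink-scaled 0<n {K} {U} 0<tU load≥ s n≤ =
    let Q , |Q|≤s , tU≤Kg = many-good-matchings 0<n {K} {U} load≥ s n≤
        n′ , t′ , H , n′-bound , t′-bound = common-pattern-restriction {K} {U} Q 0<tU tU≤Kg
    in n′ , t′ , H , n′-bound , ℕP.≤-trans t′-bound (ℕP.*-monoʳ-≤ K (ℕP.*-monoˡ-≤ t′ (ℕP.^-monoʳ-≤ 2 |Q|≤s)))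

rounds-suffice : ∀ n t .{{_ : NonZero t}} → n ≤ (n / t + 1) * t
rounds-suffice n t = begin
  n                    ≡⟨ DM.m≡m%n+[m/n]*n n t ⟩
  n DM.% t + n / t * t ≤⟨ ℕP.+-monoˡ-≤ (n / t * t) (ℕP.<⇒≤ (DM.m%n<n n t)) ⟩
  t + n / t * t        ≡⟨ solve 2 (λ k t → t :+ k :* t := (k :+ con 1) :* t) refl (n / t) t ⟩
  (n / t + 1) * t      ∎
  where open ℕP.≤-Reasoning

rounds≤exponent : ∀ {n t p q} .{{_ : NonZero t}} → p ≤ q → p * t ≤ q * n →
                  (n / t + 1) * (p * t) ≤ 4 * n * q
rounds≤exponent {n} {t} {p} {q} p≤q pt≤qn = begin
  (n / t + 1) * (p * t) ≡⟨ solve 3 (λ k p t → (k :+ con 1) :* (p :* t) := (k :* t :+ t) :* p) refl (n / t) p t ⟩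
  (n / t * t + t) * p   ≤⟨ ℕP.*-monoˡ-≤ p (ℕP.+-monoˡ-≤ t (DM.m/n*n≤m n t)) ⟩
  (n + t) * p           ≡⟨ solve 3 (λ n t p → (n :+ t) :* p := n :* p :+ p :* t) refl n t p ⟩
  n * p + p * t         ≤⟨ ℕP.+-mono-≤ (ℕP.*-monoʳ-≤ n p≤q) pt≤qn ⟩
  n * q + q * n         ≤⟨ ℕP.≤-reflexive (solve 2 (λ n q → n :* q :+ q :* n := con 2 :* n :* q) refl n q) ⟩
  2 * n * q             ≤⟨ ℕP.*-monoˡ-≤ q (ℕP.*-monoˡ-≤ n (ℕP.m≤m+n 2 2)) ⟩
  4 * n * q             ∎
  where open ℕP.≤-Reasoning

density-bounds : ∀ {n r t p q} → 0 < n → r * q ≡ p * n → r + r ≤ n → r * t ≤ n * n →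
                 p ≤ q × p * t ≤ q * n
density-bounds {n} {r} {t} {p} {q} 0<n rq≡pn 2r≤n rt≤nn = p≤q , pt≤qn
  where
  instance
    n≢0 : NonZero n
    n≢0 = >-nonZero 0<n
  open ℕP.≤-Reasoning
  p≤q : p ≤ q
  p≤q = ℕP.≤-trans (ℕP.m≤m+n p p) (ℕP.*-cancelʳ-≤ (p + p) q n (begin
    (p + p) * n   ≡⟨ solve 2 (λ p n → (p :+ p) :* n := p :* n :+ p :* n) refl p n ⟩
    p * n + p * n ≡⟨ cong₂ _+_ rq≡pn rq≡pn ⟨
    r * q + r * q ≡⟨ solve 2 (λ r q → r :* q :+ r :* q := (r :+ r) :* q) refl r q ⟩
    (r + r) * q   ≤⟨ ℕP.*-monoˡ-≤ q 2r≤n ⟩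
    n * q         ≡⟨ ℕP.*-comm n q ⟩
    q * n         ∎))
  pt≤qn : p * t ≤ q * n
  pt≤qn = ℕP.*-cancelʳ-≤ (p * t) (q * n) n (begin
    p * t * n   ≡⟨ solve 3 (λ p t n → p :* t :* n := p :* n :* t) refl p t n ⟩
    p * n * t   ≡⟨ cong (_* t) rq≡pn ⟨
    r * q * t   ≡⟨ solve 3 (λ r q t → r :* q :* t := q :* (r :* t)) refl r q t ⟩
    q * (r * t) ≤⟨ ℕP.*-monoʳ-≤ q rt≤nn ⟩
    q * (n * n) ≡⟨ ℕP.*-assoc q n n ⟨
    q * n * n   ∎)

shrink : ∀ {n r t} (M : Matchings n r t) → IsORS M → 0 < n → 0 < t → ∀ h → t ≡ h + h →
         ∀ {a b p q} → 0 < a → 0 < p → r * q ≡ p * n →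
         (∀ v → a * p * t ≤ b * q * degFrom M h v) →
         ∃ λ s → s * (p * t) ≤ 4 * n * q ×
           ∃ λ n′ → ∃ λ t′ → ORS n′ r t′ ×
             8 * (b * q * q) * n′ + 4 * (a * p * p) * n < 8 * (b * q * q) * n ×
             t * (a * p * p) ≤ 8 * (b * q * q) * (2 ^ s * t′)
shrink {n} {r} M ors 0<n 0<t h refl {a} {b} {p} {q} 0<a 0<p rq≡pn deg≥ =
  s , rounds≤exponent {n} {t} p≤q pt≤qn ,
  shrink-scaled {h = h} ors 0<n {K} {U} 0<tU load≥ s (rounds-suffice n t)
  where
  open Halves {h = h} ors
  open Covering adjacent (λ i v → matched late i v)
  t K U s : ℕ
  t = h + h
  -- with δ = a/b and c = p/q, U / K = δc² / 8
  K = 8 * (b * q * q)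
  U = a * p * p
  instance
    t≢0 : NonZero t
    t≢0 = >-nonZero 0<t
  s = n / t + 1
  0<tU : 0 < t * U
  0<tU = ℕP.*-mono-< 0<t (ℕP.*-mono-< (ℕP.*-mono-< 0<a 0<p) 0<p)
  ratios : p ≤ q × p * t ≤ q * n
  ratios = density-bounds {n} {r} {t} {p} {q} 0<n rq≡pn (r+r≤n ors (F.fromℕ< 0<t)) (begin
    r * t                            ≡⟨ solve 2 (λ r h → r :* (h :+ h) := h :* (r :+ r)) refl r h ⟩
    h * (r + r)                      ≤⟨ early-edges≤degree-sum ⟩
    ∑[ v < n ] countFin (adjacent v) ≤⟨ degree-sum≤n*n ⟩
    n * n                            ∎)
    where open ℕP.≤-Reasoning
  p≤q : p ≤ q
  p≤q = proj₁ ratios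
  pt≤qn : p * t ≤ q * n
  pt≤qn = proj₂ ratios
  load≥ : 32 * U * h * h * n ≤ K * load
  load≥ = begin
    32 * U * h * h * n                                     ≡⟨ solve 4 (λ a p h n → con 32 :* (a :* p :* p) :* h :* h :* n
                                                                   := con 8 :* (a :* p :* (h :+ h)) :* (h :* (p :* n :+ p :* n))) refl a p h n ⟩
    8 * (a * p * t) * (h * (p * n + p * n))                ≡⟨ cong (λ x → 8 * (a * p * t) * (h * (x + x))) rq≡pn ⟨
    8 * (a * p * t) * (h * (r * q + r * q))                ≡⟨ solve 4 (λ α h r q → con 8 :* α :* (h :* (r :* q :+ r :* q))
                                                                   := con 8 :* q :* (α :* (h :* (r :+ r)))) refl (a * p * t) h r q ⟩
    8 * q * (a * p * t * (h * (r + r)))                    ≤⟨ ℕP.*-monoʳ-≤ (8 * q) (ℕP.*-monoʳ-≤ (a * p * t) early-edges≤degree-sum) ⟩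
    8 * q * (a * p * t * ∑[ v < n ] countFin (adjacent v)) ≤⟨ ℕP.*-monoʳ-≤ (8 * q) (load-lower-bound {a * p * t} {b * q} late-degree≥) ⟩
    8 * q * (b * q * load)                                 ≡⟨ solve 3 (λ q b L → con 8 :* q :* (b :* q :* L)
                                                                     := con 8 :* (b :* q :* q) :* L) refl q b load ⟩
    K * load                                               ∎
    where
    open ℕP.≤-Reasoning
    late-degree≥ : ∀ v → a * p * t ≤ b * q * countFin (λ i → matched late i v)
    late-degree≥ v = subst (λ d → a * p * t ≤ b * q * d) (degFrom-late v) (deg≥ v)

-- Rational bookkeeping

-- x = N / d, for d > 0 (the denominator is stored as pred d).
IsFraction : ℚ → ℕ → ℕ → Set
IsFraction x N d = ℚ.toℚᵘ x ℚᵘ.≃ ℚᵘ.mkℚᵘ (+ N) (pred d)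

fraction-/ : ∀ N d → IsFraction (+ N ℚ./ suc d) N (suc d)
fraction-/ N d = ℚP.toℚᵘ-fromℚᵘ (ℚᵘ.mkℚᵘ (+ N) d)

fraction-ℕ : ∀ m → IsFraction (ℕ→ℚ m) m 1
fraction-ℕ m = fraction-/ m 0

fraction-of-positive : ∀ {x} → 0ℚ ℚ.< x → IsFraction x ℤ.∣ ℚ.↥ x ∣ (ℚ.↧ₙ x) × 0 < ℤ.∣ ℚ.↥ x ∣
fraction-of-positive {ℚ.mkℚ ℤ.+[1+ _ ] _ _} _ = ℚᵘP.≃-refl , s≤s z≤n
fraction-of-positive {ℚ.mkℚ (+ 0)      _ _} (ℚ.*<* (ℤ.+<+ ()))
fraction-of-positive {ℚ.mkℚ ℤ.-[1+ _ ] _ _} (ℚ.*<* ())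

module _ {x y : ℚ} {N₁ N₂ d₁ d₂ : ℕ} (x≐ : IsFraction x N₁ (suc d₁)) (y≐ : IsFraction y N₂ (suc d₂)) where

  fraction-* : IsFraction (x ℚ.* y) (N₁ * N₂) (suc d₁ * suc d₂)
  fraction-* = ℚᵘP.≃-trans (ℚP.toℚᵘ-homo-* x y) (ℚᵘP.≃-trans (ℚᵘP.*-cong x≐ y≐)
    (ℚᵘ.*≡* (cong (ℤ._* + (suc d₁ * suc d₂)) (sym (ℤP.pos-* N₁ N₂)))))

  fraction-≤ : N₁ * suc d₂ ≤ N₂ * suc d₁ → x ℚ.≤ y
  fraction-≤ le = ℚP.toℚᵘ-cancel-≤ (ℚᵘP.≤-respʳ-≃ (ℚᵘP.≃-sym y≐) (ℚᵘP.≤-respˡ-≃ (ℚᵘP.≃-sym x≐)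
    (ℚᵘ.*≤* (subst₂ ℤ._≤_ (ℤP.pos-* N₁ _) (ℤP.pos-* N₂ _) (ℤ.+≤+ le)))))

  fraction-< : N₁ * suc d₂ < N₂ * suc d₁ → x ℚ.< y
  fraction-< lt = ℚP.toℚᵘ-cancel-< (ℚᵘP.<-respʳ-≃ (ℚᵘP.≃-sym y≐) (ℚᵘP.<-respˡ-≃ (ℚᵘP.≃-sym x≐)
    (ℚᵘ.*<* (subst₂ ℤ._<_ (ℤP.pos-* N₁ _) (ℤP.pos-* N₂ _) (ℤ.+<+ lt)))))

  fraction-≤⁻ : x ℚ.≤ y → N₁ * suc d₂ ≤ N₂ * suc d₁
  fraction-≤⁻ le with ℚᵘ.*≤* le′ ← ℚᵘP.≤-respʳ-≃ y≐ (ℚᵘP.≤-respˡ-≃ x≐ (ℚP.toℚᵘ-mono-≤ le)) =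
    ℤP.drop‿+≤+ (subst₂ ℤ._≤_ (sym (ℤP.pos-* N₁ _)) (sym (ℤP.pos-* N₂ _)) le′)

  fraction-≡⁻ : x ≡ y → N₁ * suc d₂ ≡ N₂ * suc d₁
  fraction-≡⁻ eq with ℚᵘ.*≡* eq′ ← ℚᵘP.≃-trans (ℚᵘP.≃-sym x≐) (ℚᵘP.≃-trans (ℚP.toℚᵘ-cong eq) y≐) =
    ℤP.+-injective (trans (ℤP.pos-* N₁ _) (trans eq′ (sym (ℤP.pos-* N₂ _))))

fraction-1- : ∀ {x N d} → N ≤ suc d → IsFraction x N (suc d) → IsFraction (1ℚ ℚ.- x) (suc d ∸ N) (suc d)
fraction-1- {x} {N} {d} N≤ x≐ = ℚᵘP.≃-trans (ℚP.toℚᵘ-homo-+ 1ℚ (ℚ.- x))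
  (ℚᵘP.≃-trans (ℚᵘP.+-cong one≐ (ℚᵘP.≃-trans (ℚP.toℚᵘ-homo‿- x) (ℚᵘP.-‿cong x≐))) (ℚᵘ.*≡* (begin
    (+ 1 ℤ.* + suc d ℤ.+ ℤ.- + N ℤ.* + 1) ℤ.* + suc d ≡⟨ cong (ℤ._* + suc d) (cong₂ ℤ._+_ (ℤP.*-identityˡ (+ suc d)) (ℤP.*-identityʳ (ℤ.- + N))) ⟩
    (+ suc d ℤ.+ ℤ.- + N) ℤ.* + suc d                 ≡⟨ cong (ℤ._* + suc d) (trans (ℤP.m-n≡m⊖n (suc d) N) (ℤP.⊖-≥ N≤)) ⟩
    + (suc d ∸ N) ℤ.* + suc d                         ≡⟨ cong (λ e → + (suc d ∸ N) ℤ.* + e) (ℕP.*-identityˡ (suc d)) ⟨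
    + (suc d ∸ N) ℤ.* + (1 * suc d)                   ∎)))
  where
  open ≡-Reasoning
  one≐ : IsFraction 1ℚ 1 1
  one≐ = fraction-ℕ 1

ℕ→ℚ-* : ∀ m k → ℕ→ℚ (m * k) ≡ ℕ→ℚ m ℚ.* ℕ→ℚ k
ℕ→ℚ-* m k = ℚP.toℚᵘ-injective
  (ℚᵘP.≃-trans (fraction-ℕ (m * k)) (ℚᵘP.≃-sym (fraction-* (fraction-ℕ m) (fraction-ℕ k))))

ℕ→ℚ-^ : ∀ m k → ℕ→ℚ (m ^ k) ≡ ℕ→ℚ m ^ℚ k
ℕ→ℚ-^ m zero    = refl
ℕ→ℚ-^ m (suc k) = trans (ℕ→ℚ-* m (m ^ k)) (cong (ℕ→ℚ m ℚ.*_) (ℕ→ℚ-^ m k))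

ℕ→ℚ-mono-≤ : ∀ {m k} → m ≤ k → ℕ→ℚ m ℚ.≤ ℕ→ℚ k
ℕ→ℚ-mono-≤ {m} {k} m≤k = fraction-≤ (fraction-ℕ m) (fraction-ℕ k) (ℕP.*-monoˡ-≤ 1 m≤k)

^ℚ-nonNeg : ∀ {x} k → 0ℚ ℚ.≤ x → 0ℚ ℚ.≤ x ^ℚ k
^ℚ-nonNeg     zero    _   = ℕ→ℚ-mono-≤ {0} {1} z≤n
^ℚ-nonNeg {x} (suc k) 0≤x =
  subst (ℚ._≤ x ℚ.* (x ^ℚ k)) (ℚP.*-zeroʳ x) (ℚP.*-monoˡ-≤-nonNeg x {{ℚ.nonNegative 0≤x}} (^ℚ-nonNeg k 0≤x))

^ℚ-mono-≤ : ∀ {x y} k → 0ℚ ℚ.≤ x → x ℚ.≤ y → x ^ℚ k ℚ.≤ y ^ℚ k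
^ℚ-mono-≤         zero    _   _   = ℚP.≤-refl
^ℚ-mono-≤ {x} {y} (suc k) 0≤x x≤y = ℚP.≤-trans
  (ℚP.*-monoʳ-≤-nonNeg (x ^ℚ k) {{ℚ.nonNegative (^ℚ-nonNeg k 0≤x)}} x≤y)
  (ℚP.*-monoˡ-≤-nonNeg y {{ℚ.nonNegative (ℚP.≤-trans 0≤x x≤y)}} (^ℚ-mono-≤ k 0≤x x≤y))

^-distribʳ-* : ∀ m k e → (m * k) ^ e ≡ m ^ e * k ^ e
^-distribʳ-* m k zero    = refl
^-distribʳ-* m k (suc e) = trans (cong (m * k *_) (^-distribʳ-* m k e))
  (solve 4 (λ m k x y → m :* k :* (x :* y) := m :* x :* (k :* y)) refl m k (m ^ e) (k ^ e))

scaled-power≤ : ∀ {s e P t′} → s * e ≤ P → (2 ^ s * t′) ^ e ≤ t′ ^ e * 2 ^ P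
scaled-power≤ {s} {e} {P} {t′} se≤P = begin
  (2 ^ s * t′) ^ e     ≡⟨ ^-distribʳ-* (2 ^ s) t′ e ⟩
  (2 ^ s) ^ e * t′ ^ e ≡⟨ cong (_* t′ ^ e) (ℕP.^-*-assoc 2 s e) ⟩
  2 ^ (s * e) * t′ ^ e ≤⟨ ℕP.*-monoˡ-≤ (t′ ^ e) (ℕP.^-monoʳ-≤ 2 se≤P) ⟩
  2 ^ P * t′ ^ e       ≡⟨ ℕP.*-comm (2 ^ P) (t′ ^ e) ⟩
  t′ ^ e * 2 ^ P       ∎
  where open ℕP.≤-Reasoning

LeTimesPow2-intro : ∀ {X t′ s e P} → s * e ≤ P → X ℚ.≤ ℕ→ℚ (2 ^ s * t′) → LeTimesPow2 X (ℕ→ℚ t′) P e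
LeTimesPow2-intro {X} {t′} {s} {e} {P} se≤P X≤ with ℚP.≤-total X 0ℚ
... | inj₁ X≤0 = inj₁ X≤0
... | inj₂ 0≤X = inj₂ (begin
  X ^ℚ e                         ≤⟨ ^ℚ-mono-≤ e 0≤X X≤ ⟩
  ℕ→ℚ (2 ^ s * t′) ^ℚ e          ≡⟨ ℕ→ℚ-^ (2 ^ s * t′) e ⟨
  ℕ→ℚ ((2 ^ s * t′) ^ e)         ≤⟨ ℕ→ℚ-mono-≤ (scaled-power≤ {s} {e} {P} {t′} se≤P) ⟩
  ℕ→ℚ (t′ ^ e * 2 ^ P)           ≡⟨ trans (ℕ→ℚ-* (t′ ^ e) (2 ^ P)) (cong₂ ℚ._*_ (ℕ→ℚ-^ t′ e) (ℕ→ℚ-^ 2 P)) ⟩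
  (ℕ→ℚ t′ ^ℚ e) ℚ.* (ℕ→ℚ 2 ^ℚ P) ∎)
  where open ℚP.≤-Reasoning

vertex-gap : ∀ {B U n n′} → 8 * B * n′ + 4 * U * n < 8 * B * n →
             U ≤ B * 2 × n′ * (B * 2) < (B * 2 ∸ U) * n
vertex-gap {B} {U} {n} {n′} H = U≤2B , subst (n′ * (B * 2) <_) (sym (ℕP.*-distribʳ-∸ n (B * 2) U))
                                                (ℕP.m+n≤o⇒m≤o∸n (suc (n′ * (B * 2))) gap)
  where
  gap : n′ * (B * 2) + U * n < B * 2 * n
  gap = ℕP.*-cancelˡ-< 4 _ _ (subst₂ _<_
    (solve 4 (λ B U n n′ → con 8 :* B :* n′ :+ con 4 :* U :* n := con 4 :* (n′ :* (B :* con 2) :+ U :* n)) refl B U n n′)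
    (solve 2 (λ B n → con 8 :* B :* n := con 4 :* (B :* con 2 :* n)) refl B n) H)
  U≤2B : U ≤ B * 2
  U≤2B = ℕP.<⇒≤ (ℕP.*-cancelʳ-< n U (B * 2) (ℕP.≤-<-trans (ℕP.m≤n+m (U * n) _) gap))

module _ {δ c : ℚ} {a p b′ q′ : ℕ} (δ≐a/b : IsFraction δ a (suc b′)) (c≐p/q : IsFraction c p (suc q′)) where
  private
    b q : ℕ
    b = suc b′
    q = suc q′

  r≡cn⇒rq≡pn : ∀ {r n} → ℕ→ℚ r ≡ c ℚ.* ℕ→ℚ n → r * q ≡ p * n
  r≡cn⇒rq≡pn {r} {n} r≡cn = trans (cong (r *_) (sym (ℕP.*-identityʳ q)))
    (trans (fraction-≡⁻ (fraction-ℕ r) (fraction-* c≐p/q (fraction-ℕ n)) r≡cn) (ℕP.*-identityʳ (p * n)))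

  δct≤d⇒apt≤bqd : ∀ {t d} → δ ℚ.* c ℚ.* ℕ→ℚ t ℚ.≤ ℕ→ℚ d → a * p * t ≤ b * q * d
  δct≤d⇒apt≤bqd {t} {d} δct≤d = subst₂ _≤_ (ℕP.*-identityʳ (a * p * t))
    (trans (cong (d *_) (ℕP.*-identityʳ (b * q))) (ℕP.*-comm d (b * q)))
    (fraction-≤⁻ (fraction-* (fraction-* δ≐a/b c≐p/q) (fraction-ℕ t)) (fraction-ℕ d) δct≤d)

  vertex-bound : ∀ {n n′} → 8 * (b * q * q) * n′ + 4 * (a * p * p) * n < 8 * (b * q * q) * n →
                 ℕ→ℚ n′ ℚ.< (1ℚ ℚ.- δ ℚ.* c ℚ.* c ℚ.* (+ 1 ℚ./ 2)) ℚ.* ℕ→ℚ n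
  vertex-bound {n} {n′} H = fraction-< (fraction-ℕ n′) (fraction-* (fraction-1- U≤2B Y≐) (fraction-ℕ n))
    (subst₂ _<_ (cong (n′ *_) (sym (ℕP.*-identityʳ (B * 2)))) (sym (ℕP.*-identityʳ _)) n′2B<)
    where
    B U : ℕ
    B = b * q * q
    U = a * p * p
    Y≐ : IsFraction (δ ℚ.* c ℚ.* c ℚ.* (+ 1 ℚ./ 2)) U (B * 2)
    Y≐ = subst (λ N → IsFraction (δ ℚ.* c ℚ.* c ℚ.* (+ 1 ℚ./ 2)) N (B * 2)) (ℕP.*-identityʳ U)
           (fraction-* (fraction-* (fraction-* δ≐a/b c≐p/q) c≐p/q) (fraction-/ 1 1))
    U≤2B : U ≤ B * 2
    U≤2B = proj₁ (vertex-gap {B} {U} H)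
    n′2B< : n′ * (B * 2) < (B * 2 ∸ U) * n
    n′2B< = proj₂ (vertex-gap {B} {U} H)

  matching-bound : ∀ {t m} → t * (a * p * p) ≤ 8 * (b * q * q) * m →
                   δ ℚ.* c ℚ.* c ℚ.* ℕ→ℚ t ℚ.* (+ 1 ℚ./ 8) ℚ.≤ ℕ→ℚ m
  matching-bound {t} {m} H = fraction-≤
    (fraction-* (fraction-* (fraction-* (fraction-* δ≐a/b c≐p/q) c≐p/q) (fraction-ℕ t)) (fraction-/ 1 7)) (fraction-ℕ m)
    (subst₂ _≤_
      (solve 3 (λ t a p → t :* (a :* p :* p) := a :* p :* p :* t :* con 1 :* con 1) refl t a p)
      (solve 2 (λ B m → con 8 :* B :* m := m :* (B :* con 1 :* con 8)) refl (b * q * q) m) H)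

half+half : ∀ {t} → 2 ∣ t → t ≡ t / 2 + t / 2
half+half {t} 2∣t = trans (sym (DM.m/n*n≡m 2∣t)) (solve 1 (λ h → h :* con 2 := h :+ h) refl (t / 2))

lemma6 : (c δ : ℚ) (n r t : ℕ) → 0ℚ ℚ.< c → 0ℚ ℚ.< δ →
         0 ℕ.< n → 0 ℕ.< t → 2 ∣ t →
         ℕ→ℚ r ≡ c ℚ.* ℕ→ℚ n →
         (G : ORS n r t) →
         (∀ (v : Fin n) → δ ℚ.* c ℚ.* ℕ→ℚ t ℚ.≤ ℕ→ℚ (degFrom (proj₁ G) (t / 2) v)) →
         Σ ℕ λ n' → Σ ℕ λ t' → ORS n' r t'
           × ℕ→ℚ n' ℚ.< (1ℚ ℚ.- δ ℚ.* c ℚ.* c ℚ.* (+ 1 ℚ./ 2)) ℚ.* ℕ→ℚ n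
           × LeTimesPow2 (δ ℚ.* c ℚ.* c ℚ.* ℕ→ℚ t ℚ.* (+ 1 ℚ./ 8)) (ℕ→ℚ t') (xNum n c) (xDen c t)
lemma6 c δ n r t 0<c 0<δ 0<n 0<t 2∣t r≡cn (M , ors) δct≤deg =
  let c≐p/q , 0<p = fraction-of-positive {c} 0<c
      δ≐a/b , 0<a = fraction-of-positive {δ} 0<δ
      s , s≤x , n′ , t′ , H , n′-bound , t′-bound =
        shrink M ors 0<n 0<t (t / 2) (half+half 2∣t) {b = ℚ.↧ₙ δ} 0<a 0<p
          (r≡cn⇒rq≡pn δ≐a/b c≐p/q {r} {n} r≡cn) (δct≤d⇒apt≤bqd δ≐a/b c≐p/q {t} ∘ δct≤deg)
  in n′ , t′ , H , vertex-bound δ≐a/b c≐p/q {n} {n′} n′-bound ,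
     LeTimesPow2-intro {t′ = t′} {s} s≤x (matching-bound δ≐a/b c≐p/q {t} {2 ^ s * t′} t′-bound)
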